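{- Let $\mathbf{C}$ be the natural deduction system described in the context. Every deduction in $\mathbf{C}$ in normal form has the subformula property: every formula occurring in it is a subformula of its conclusion or of one of its undischarged assumptions.
   Context: Formulas are built from atomic formulas (formulas containing no connective) by the connectives $\neg$ (unary), $\supset$, $\land$, $\lor$. Deductions in $\mathbf{C}$ are trees of formula occurrences whose leaves are assumptions; each assumption belongs to an assumption class marked by a number, and a rule discharging class $i$ (written $[X]^i$) discharges all assumptions of that class above the indicated premise. A single assumption $A$ is a deduction of $A$ from $A$. Rules ($C$ arbitrary): $\land I$: from $A$, $B$, and a deduction of $C$ from $[A\land B]$, infer $C$. $\land E$: from $A\land B$ and a deduction of $C$ from $[A]$, $[B]$, infer $C$. $\lor I$: from $A$ (or from $B$) and a deduction of $C$ from $[A\lor B]$, infer $C$. $\lor E$: from $A\lor B$, a deduction of $C$ from $[A]$, and a deduction of $C$ from $[B]$, infer $C$. $\supset I$: from $B$ and a deduction of $C$ from $[A\supset B]$, infer $C$. $TR$ (an introduction rule for $\supset$): from a deduction of $C$ from $[A]$ and a deduction of $C$ from $[A\supset B]$, infer $C$. $\supset E$: from $A\supset B$, $A$, and a deduction of $C$ from $[B]$, infer $C$. $\neg I$: from a deduction of $C$ from $[A]$ and a deduction of $C$ from $[\neg A]$, infer $C$. $\neg E$: from $\neg A$ and $A$, infer $C$. Introduction rules: $\land I,\lor I,\supset I,TR,\neg I$; elimination rules: $\land E,\lor E,\supset E,\neg E$. In elimination rules $A\land B, A\lor B, A\supset B,\neg A$ are the major premises; premises in the place of $C$ (in any rule)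 are arbitrary premises; the discharged $A\land B$, $A\lor B$, $A\supset B$ (in $\supset I$ and $TR$), $\neg A$ (in $\neg I$) are the major assumptions discharged by the introduction rule. Convention: there is no vacuous discharge above arbitrary premises (every discharge in a rule application above an arbitrary premise discharges at least one assumption occurrence, except that $\land E$ may discharge only one of $A$, $B$). A maximal formula is an occurrence of a formula with main connective $\ast$ that is both the major premise of an application of $\ast E$ and the major assumption discharged by an application of $\ast I$ (or of $TR$ when $\ast$ is $\supset$). A segment is a sequence $C_1,\dots,C_n$ of occurrences of the same formula such that for all $i<n$, $C_i$ is an arbitrary premise of a rule application whose conclusion is $C_{i+1}$, $C_n$ is not an arbitrary premise of any rule application, and either $n>1$, or $n\ge 1$ and $C_1$ is the conclusion of an application of $\neg E$. A maximal segment is a segment whose last formula is the major premise of an elimination rule. A deduction is in normal form if it contains neither maximal formulas nor maximal segments. -}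

module Defs where

open import Data.Nat using (ℕ; suc; _>_; _≥_)
open import Data.List using (List; []; _∷_)
open import Data.List.Membership.Propositional using (_∈_)
open import Data.List.Relation.Unary.Any using (Any)
open import Data.Product using (Σ; ∃; ∃-syntax; _×_; _,_; proj₁; proj₂)
open import Data.Sum using (_⊎_)
open import Relation.Binary.PropositionalEquality using (_≡_)
open import Relation.Nullary using (¬_)

infixr 5 _⊃_
infixr 6 _∨'_
infixr 7 _∧'_

data Fm : Set where
  atom : ℕ → Fm
  ¬'_  : Fm → Fm
  _⊃_  : Fm → Fm → Fm
  _∧'_ : Fm → Fm → Fm
  _∨'_ : Fm → Fm → Fm

data _≼_ : Fm → Fm → Set where
  ≼-refl : ∀ {A} → A ≼ A
  ≼-¬    : ∀ {A B}   → A ≼ B → A ≼ (¬' B)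
  ≼-⊃ˡ   : ∀ {A B C} → A ≼ B → A ≼ (B ⊃ C)
  ≼-⊃ʳ   : ∀ {A B C} → A ≼ C → A ≼ (B ⊃ C)
  ≼-∧ˡ   : ∀ {A B C} → A ≼ B → A ≼ (B ∧' C)
  ≼-∧ʳ   : ∀ {A B C} → A ≼ C → A ≼ (B ∧' C)
  ≼-∨ˡ   : ∀ {A B C} → A ≼ B → A ≼ (B ∨' C)
  ≼-∨ʳ   : ∀ {A B C} → A ≼ C → A ≼ (B ∨' C)

-- Deduction trees of the system C, indexed by their conclusion.
-- Natural-number arguments are assumption-class labels; each label
-- accompanies the premise above which that class is discharged.

data Ded : Fm → Set where
  hyp : (i : ℕ) (A : Fm) → Ded A
  -- ∧I : A, B, [A∧B]^i ... C  ⊢ C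
  ∧I  : ∀ {A B C} → Ded A → Ded B → (i : ℕ) → Ded C → Ded C
  -- ∧E : A∧B, [A]^i [B]^j ... C  ⊢ C
  ∧E  : ∀ {A B C} → Ded (A ∧' B) → (i j : ℕ) → Ded C → Ded C
  -- ∨I : A, [A∨B]^i ... C ⊢ C   resp.  B, [A∨B]^i ... C ⊢ C
  ∨I₁ : ∀ {A C} (B : Fm) → Ded A → (i : ℕ) → Ded C → Ded C
  ∨I₂ : ∀ {B C} (A : Fm) → Ded B → (i : ℕ) → Ded C → Ded C
  -- ∨E : A∨B, [A]^i ... C, [B]^j ... C ⊢ C
  ∨E  : ∀ {A B C} → Ded (A ∨' B) → (i : ℕ) → Ded C → (j : ℕ) → Ded C → Ded C
  -- ⊃I : B, [A⊃B]^i ... C ⊢ C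
  ⊃I  : ∀ {B C} (A : Fm) → Ded B → (i : ℕ) → Ded C → Ded C
  -- TR : [A]^i ... C, [A⊃B]^j ... C ⊢ C
  TR  : ∀ {C} (A B : Fm) → (i : ℕ) → Ded C → (j : ℕ) → Ded C → Ded C
  -- ⊃E : A⊃B, A, [B]^i ... C ⊢ C
  ⊃E  : ∀ {A B C} → Ded (A ⊃ B) → Ded A → (i : ℕ) → Ded C → Ded C
  -- ¬I : [A]^i ... C, [¬A]^j ... C ⊢ C
  ¬I  : ∀ {C} (A : Fm) → (i : ℕ) → Ded C → (j : ℕ) → Ded C → Ded C
  ¬E  : ∀ {A} (C : Fm) → Ded (¬' A) → Ded A → Ded C

data Kind : Set where
  major     : Kind
  arbitrary : Kind   -- premise in the place of C
  other     : Kind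

record Prem : Set where
  constructor prem
  field
    kind : Kind
    fm   : Fm
    sub  : Ded fm
    dis  : List (ℕ × Fm)
open Prem public

prems : ∀ {C} → Ded C → List Prem
prems (hyp i A) = []
prems (∧I {A} {B} {C} d e i f) =
  prem other A d [] ∷ prem other B e [] ∷ prem arbitrary C f ((i , A ∧' B) ∷ []) ∷ []
prems (∧E {A} {B} {C} d i j f) =
  prem major (A ∧' B) d [] ∷ prem arbitrary C f ((i , A) ∷ (j , B) ∷ []) ∷ []
prems (∨I₁ {A} {C} B d i f) =
  prem other A d [] ∷ prem arbitrary C f ((i , A ∨' B) ∷ []) ∷ []
prems (∨I₂ {B} {C} A d i f) =
  prem other B d [] ∷ prem arbitrary C f ((i , A ∨' B) ∷ []) ∷ []
prems (∨E {A} {B} {C} d i f j g) =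
  prem major (A ∨' B) d [] ∷ prem arbitrary C f ((i , A) ∷ []) ∷
  prem arbitrary C g ((j , B) ∷ []) ∷ []
prems (⊃I {B} {C} A d i f) =
  prem other B d [] ∷ prem arbitrary C f ((i , A ⊃ B) ∷ []) ∷ []
prems (TR {C} A B i f j g) =
  prem arbitrary C f ((i , A) ∷ []) ∷ prem arbitrary C g ((j , A ⊃ B) ∷ []) ∷ []
prems (⊃E {A} {B} {C} d e i f) =
  prem major (A ⊃ B) d [] ∷ prem other A e [] ∷ prem arbitrary C f ((i , B) ∷ []) ∷ []
prems (¬I {C} A i f j g) =
  prem arbitrary C f ((i , A) ∷ []) ∷ prem arbitrary C g ((j , ¬' A) ∷ []) ∷ []
prems (¬E {A} C d e) =
  prem major (¬' A) d [] ∷ prem other A e [] ∷ []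

-- Introduction-rule application N discharging its major assumption F,
-- of class i, above its arbitrary premise P.
data IntroMajor : ∀ {C D} → Ded C → ℕ → Fm → Ded D → Set where
  im-∧I  : ∀ {A B C} (d : Ded A) (e : Ded B) i (f : Ded C) →
           IntroMajor (∧I d e i f) i (A ∧' B) f
  im-∨I₁ : ∀ {A C} B (d : Ded A) i (f : Ded C) →
           IntroMajor (∨I₁ B d i f) i (A ∨' B) f
  im-∨I₂ : ∀ {B C} A (d : Ded B) i (f : Ded C) →
           IntroMajor (∨I₂ A d i f) i (A ∨' B) f
  im-⊃I  : ∀ {B C} A (d : Ded B) i (f : Ded C) →
           IntroMajor (⊃I A d i f) i (A ⊃ B) f
  im-TR  : ∀ {C} A B i (f : Ded C) j (g : Ded C) →
           IntroMajor (TR A B i f j g) j (A ⊃ B) g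
  im-¬I  : ∀ {C} A i (f : Ded C) j (g : Ded C) →
           IntroMajor (¬I A i f j g) j (¬' A) g

data _⊑_ {A} (E : Ded A) : ∀ {B} → Ded B → Set where
  here  : E ⊑ E
  there : ∀ {B} {D : Ded B} {p} → p ∈ prems D → E ⊑ sub p → E ⊑ D

data FreeIn (i : ℕ) {A} (E : Ded A) : ∀ {B} → Ded B → Set where
  here  : FreeIn i E E
  there : ∀ {B} {D : Ded B} {p} → p ∈ prems D →
          ¬ Any (λ x → proj₁ x ≡ i) (dis p) →
          FreeIn i E (sub p) → FreeIn i E D

OpenAss : ∀ {B} → ℕ → Fm → Ded B → Set
OpenAss i A D = FreeIn i (hyp i A) D

Occurs : ∀ {B} → Fm → Ded B → Set
Occurs F D = Σ (Ded F) (λ N → N ⊑ D)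

-- Well-formedness of discharges:
--  * all assumptions of a discharged class i above the premise have the
--    discharged formula;
--  * no vacuous discharge above arbitrary premises: each discharge
--    discharges at least one occurrence, except that ∧E (whose premise
--    carries two discharges) need only discharge one of A, B.

WF : ∀ {C} → Ded C → Set
WF D = ∀ {B} (N : Ded B) → N ⊑ D → ∀ {p} → p ∈ prems N →
         (∀ {i F} → (i , F) ∈ dis p → ∀ A → OpenAss i A (sub p) → A ≡ F)
       × (dis p ≡ [] ⊎ Any (λ x → OpenAss (proj₁ x) (proj₂ x) (sub p)) (dis p))

-- An occurrence of an assumption F of class i which is the major premise
-- of an elimination rule, discharged by an introduction rule (or TR)
-- as its major assumption.
MaxFormula : ∀ {C} → Ded C → Set
MaxFormula D =
  ∃ λ B → Σ (Ded B) λ N → N ⊑ D × (∃ λ i → ∃ λ F → ∃ λ P' →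
    Σ (Ded P') λ P → IntroMajor N i F P ×
      (∃ λ E' → Σ (Ded E') λ E → FreeIn i E P ×
         prem major F (hyp i F) [] ∈ prems E))

-- ChainFrom S D n : a sequence C₁ = (root of S), …, Cₙ = (root of D) of
-- occurrences where each Cₖ (k < n) is an arbitrary premise of the rule
-- application whose conclusion is Cₖ₊₁.
data ChainFrom {A} (S : Ded A) : ∀ {C} → Ded C → ℕ → Set where
  start : ChainFrom S S 1
  step  : ∀ {C} {D : Ded C} {p n} → p ∈ prems D → kind p ≡ arbitrary →
          ChainFrom S (sub p) n → ChainFrom S D (suc n)

data IsNegE : ∀ {A} → Ded A → Set where
  negE : ∀ {A} C (d : Ded (¬' A)) (e : Ded A) → IsNegE (¬E C d e)

SegmentTo : ∀ {C} → Ded C → Set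
SegmentTo D = ∃ λ A → Σ (Ded A) λ S → ∃ λ n →
  ChainFrom S D n × (n > 1 ⊎ (n ≥ 1 × IsNegE S))

MaxSegment : ∀ {C} → Ded C → Set
MaxSegment D = ∃ λ B → Σ (Ded B) λ E → E ⊑ D ×
  (Σ Prem λ p → p ∈ prems E × kind p ≡ major × SegmentTo (sub p))

Normal : ∀ {C} → Ded C → Set
Normal D = ¬ MaxFormula D × ¬ MaxSegment D

{-# OPTIONS --safe #-}
-- Proof by induction on deductions, for a stronger invariant (Bounded): every
-- formula is a subformula of the conclusion or of an open assumption standing as
-- the major premise of an elimination.  In a normal deduction the major premise
-- of an elimination cannot end a segment, so it is an assumption, and what the
-- elimination discharges or takes as minor premise is a subformula of it.  An
-- introduction discharges its major assumption above a premise with the same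
-- conclusion; the assumption is bounded there by induction, and not by itself,
-- for then it would be a maximal formula.  The minor premises and remaining
-- discharges of an introduction are subformulas of its major assumption.

module Submission where

open import Defs
open import Data.Nat using (ℕ; _≟_)
open import Data.Nat.Properties using (n<1+n)
open import Data.List using (List; []; _∷_)
open import Data.List.Membership.Propositional using (_∈_; find)
open import Data.List.Relation.Unary.Any using (Any; here; there; any?)
open import Data.Product using (Σ; ∃; ∃-syntax; _×_; _,_; proj₁; proj₂)
open import Data.Sum using (_⊎_; inj₁; inj₂)
open import Data.Empty using (⊥-elim)
open import Relation.Nullary using (¬_; yes; no)
open import Relation.Binary.PropositionalEquality using (_≡_; refl)

≼-trans : ∀ {A B C} → A ≼ B → B ≼ C → A ≼ C
≼-trans p ≼-refl   = p
≼-trans p (≼-¬ q)  = ≼-¬ (≼-trans p q)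
≼-trans p (≼-⊃ˡ q) = ≼-⊃ˡ (≼-trans p q)
≼-trans p (≼-⊃ʳ q) = ≼-⊃ʳ (≼-trans p q)
≼-trans p (≼-∧ˡ q) = ≼-∧ˡ (≼-trans p q)
≼-trans p (≼-∧ʳ q) = ≼-∧ʳ (≼-trans p q)
≼-trans p (≼-∨ˡ q) = ≼-∨ˡ (≼-trans p q)
≼-trans p (≼-∨ʳ q) = ≼-∨ʳ (≼-trans p q)

FreeIn-trans : ∀ {i A B C} {X : Ded A} {Y : Ded B} {Z : Ded C} →
               FreeIn i X Y → FreeIn i Y Z → FreeIn i X Z
FreeIn-trans p here             = p
FreeIn-trans p (there pm nd q) = there pm nd (FreeIn-trans p q)

FreeIn⇒⊑ : ∀ {i A B} {X : Ded A} {Y : Ded B} → FreeIn i X Y → X ⊑ Y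
FreeIn⇒⊑ here            = here
FreeIn⇒⊑ (there pm _ p) = there pm (FreeIn⇒⊑ p)

premise-induction : (P : ∀ {C} → Ded C → Set) →
                    (∀ {C} (D : Ded C) → (∀ {p} → p ∈ prems D → P (sub p)) → P D) →
                    ∀ {C} (D : Ded C) → P D
premise-induction P ind-step = go
  where
  go : ∀ {C} (D : Ded C) → P D
  go D@(hyp i A)         = ind-step D λ ()
  go D@(∧I d e i f)      = ind-step D λ { (here refl) → go d ; (there (here refl)) → go e
                                        ; (there (there (here refl))) → go f }
  go D@(∧E d i j f)      = ind-step D λ { (here refl) → go d ; (there (here refl)) → go f }
  go D@(∨I₁ B d i f)     = ind-step D λ { (here refl) → go d ; (there (here refl)) → go f }
  go D@(∨I₂ A d i f)     = ind-step D λ { (here refl) → go d ; (there (here refl)) → go f }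
  go D@(∨E d i f j g)    = ind-step D λ { (here refl) → go d ; (there (here refl)) → go f
                                        ; (there (there (here refl))) → go g }
  go D@(⊃I A d i f)      = ind-step D λ { (here refl) → go d ; (there (here refl)) → go f }
  go D@(TR A B i f j g)  = ind-step D λ { (here refl) → go f ; (there (here refl)) → go g }
  go D@(⊃E d e i f)      = ind-step D λ { (here refl) → go d ; (there (here refl)) → go e
                                        ; (there (there (here refl))) → go f }
  go D@(¬I A i f j g)    = ind-step D λ { (here refl) → go f ; (there (here refl)) → go g }
  go D@(¬E C d e)        = ind-step D λ { (here refl) → go d ; (there (here refl)) → go e }

WF-premise : ∀ {C} {D : Ded C} {p} → p ∈ prems D → WF D → WF (sub p)
WF-premise pm w N N⊑ = w N (there pm N⊑)

Normal-premise : ∀ {C} {D : Ded C} {p} → p ∈ prems D → Normal D → Normal (sub p)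
Normal-premise pm (no-max-formula , no-max-segment) =
    (λ { (B , N , N⊑ , max) → no-max-formula (B , N , there pm N⊑ , max) })
  , (λ { (B , E , E⊑ , max) → no-max-segment (B , E , there pm E⊑ , max) })

discharged-open : ∀ {C X K i G} {D : Ded C} {s : Ded X} →
                  prem K X s ((i , G) ∷ []) ∈ prems D → WF D → OpenAss i G s
discharged-open pm w with proj₂ (w _ here pm)
... | inj₂ (here open-ass) = open-ass

MajorOpen : ∀ {B} → ℕ → Fm → Ded B → Set
MajorOpen i A D = ∃ λ E' → Σ (Ded E') λ E →
  FreeIn i E D × prem major A (hyp i A) [] ∈ prems E

MajorOpen⇒OpenAss : ∀ {i A B} {D : Ded B} → MajorOpen i A D → OpenAss i A D
MajorOpen⇒OpenAss (_ , _ , free , pm) = FreeIn-trans (there pm (λ ()) here) free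

MajorOpen-premise : ∀ {C k A} {D : Ded C} {p} → p ∈ prems D →
                    ¬ Any (λ x → proj₁ x ≡ k) (dis p) →
                    MajorOpen k A (sub p) → MajorOpen k A D
MajorOpen-premise pm nd (E' , E , free , major-pm) = E' , E , there pm nd free , major-pm

Bounded : ∀ {C} → Ded C → Fm → Set
Bounded {C} D F = F ≼ C ⊎ ∃[ i ] ∃[ A ] (MajorOpen i A D × F ≼ A)

Bounded-≼ : ∀ {C F G} {D : Ded C} → F ≼ G → Bounded D G → Bounded D F
Bounded-≼ p (inj₁ q)                = inj₁ (≼-trans p q)
Bounded-≼ p (inj₂ (i , A , mo , q)) = inj₂ (i , A , mo , ≼-trans p q)

DischargesBounded : ∀ {C X} → Ded C → Ded X → List (ℕ × Fm) → Set
DischargesBounded D s ds = ∀ {i G} → (i , G) ∈ ds → MajorOpen i G s → Bounded D G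

-- A formula bounded in a premise is bounded in D: either its witness stays open
-- in D, or WF identifies the witness with a formula discharged at the premise.
bounded-from-premise : ∀ {C} {D : Ded C} {p} → WF D → p ∈ prems D →
                       Bounded D (fm p) × DischargesBounded D (sub p) (dis p) →
                       ∀ {F} → Bounded (sub p) F → Bounded D F
bounded-from-premise w pm (premise-bounded , _) (inj₁ q) = Bounded-≼ q premise-bounded
bounded-from-premise {p = p} w pm (_ , discharges-bounded) (inj₂ (k , A , mo , q))
  with any? (λ x → proj₁ x ≟ k) (dis p)
... | no free = inj₂ (k , A , MajorOpen-premise pm free mo , q)
... | yes discharged with find discharged
... | (.k , G) , ∈dis , refl with proj₁ (w _ here pm) ∈dis A (MajorOpen⇒OpenAss mo)
... | refl = Bounded-≼ q (discharges-bounded ∈dis mo)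

data IsHyp : ∀ {G} → Ded G → Set where
  isHyp : ∀ k G → IsHyp (hyp k G)

arbitrary-premise-segment : ∀ {C} {D : Ded C} {p} → p ∈ prems D →
                            kind p ≡ arbitrary → SegmentTo D
arbitrary-premise-segment {p = p} pm arb = _ , sub p , 2 , step pm arb start , inj₁ (n<1+n 1)

hyp-or-segment : ∀ {G} (d : Ded G) → IsHyp d ⊎ SegmentTo d
hyp-or-segment (hyp k G)        = inj₁ (isHyp k G)
hyp-or-segment (∧I d e i f)     = inj₂ (arbitrary-premise-segment (there (there (here refl))) refl)
hyp-or-segment (∧E d i j f)     = inj₂ (arbitrary-premise-segment (there (here refl)) refl)
hyp-or-segment (∨I₁ B d i f)    = inj₂ (arbitrary-premise-segment (there (here refl)) refl)
hyp-or-segment (∨I₂ A d i f)    = inj₂ (arbitrary-premise-segment (there (here refl)) refl)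
hyp-or-segment (∨E d i f j g)   = inj₂ (arbitrary-premise-segment (there (here refl)) refl)
hyp-or-segment (⊃I A d i f)     = inj₂ (arbitrary-premise-segment (there (here refl)) refl)
hyp-or-segment (TR A B i f j g) = inj₂ (arbitrary-premise-segment (here refl) refl)
hyp-or-segment (⊃E d e i f)     = inj₂ (arbitrary-premise-segment (there (there (here refl))) refl)
hyp-or-segment (¬I A i f j g)   = inj₂ (arbitrary-premise-segment (here refl) refl)
hyp-or-segment (¬E C d e)       = inj₂ (_ , ¬E C d e , 1 , start , inj₂ (n<1+n 0 , negE C d e))

major-premise-bounded : ∀ {C G} {D : Ded C} {d : Ded G} → Normal D →
                        prem major G d [] ∈ prems D → Bounded D G
major-premise-bounded {d = d} n pm with hyp-or-segment d
... | inj₁ (isHyp k G) = inj₂ (k , G , (_ , _ , here , pm) , ≼-refl)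
... | inj₂ segment     = ⊥-elim (proj₂ n (_ , _ , here , _ , pm , refl , segment))

intro-premise : ∀ {C i G} {N P : Ded C} → IntroMajor N i G P →
                prem arbitrary C P ((i , G) ∷ []) ∈ prems N
intro-premise (im-∧I d e i f)      = there (there (here refl))
intro-premise (im-∨I₁ B d i f)     = there (here refl)
intro-premise (im-∨I₂ A d i f)     = there (here refl)
intro-premise (im-⊃I A d i f)      = there (here refl)
intro-premise (im-TR A B i f j g)  = there (here refl)
intro-premise (im-¬I A i f j g)    = there (here refl)

intro-discharge-bounded : ∀ {C i G} {N P : Ded C} → Normal N → IntroMajor N i G P →
                          DischargesBounded N P ((i , G) ∷ [])
intro-discharge-bounded n im (here refl) mo = ⊥-elim (proj₁ n (_ , _ , here , _ , _ , _ , _ , im , mo))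

OccurrencesBounded : ∀ {C} → Ded C → Set
OccurrencesBounded D = ∀ F → Occurs F D → Bounded D F

PremisesBounded : ∀ {C} → Ded C → Set
PremisesBounded D = ∀ {p} → p ∈ prems D → OccurrencesBounded (sub p)

intro-major-bounded : ∀ {C i G} {N P : Ded C} → WF N → Normal N → PremisesBounded N →
                      IntroMajor N i G P → Bounded N G
intro-major-bounded {i = i} {G} w n ih im =
  bounded-from-premise w pm (inj₁ ≼-refl , intro-discharge-bounded n im)
    (ih pm G (hyp i G , FreeIn⇒⊑ (discharged-open pm w)))
  where pm = intro-premise im

sole-discharge-bounded : ∀ {C X i G} {D : Ded C} {s : Ded X} → Bounded D G →
                         DischargesBounded D s ((i , G) ∷ [])
sole-discharge-bounded bounded (here refl) _ = bounded

premises-bounded : ∀ {C} (D : Ded C) → WF D → Normal D → PremisesBounded D →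
                   ∀ {p} → p ∈ prems D → Bounded D (fm p) × DischargesBounded D (sub p) (dis p)
premises-bounded (∧I d e i f) w n ih = λ where
    (here refl)                 → Bounded-≼ (≼-∧ˡ ≼-refl) conj , λ ()
    (there (here refl))         → Bounded-≼ (≼-∧ʳ ≼-refl) conj , λ ()
    (there (there (here refl))) → inj₁ ≼-refl , intro-discharge-bounded n (im-∧I d e i f)
  where conj = intro-major-bounded w n ih (im-∧I d e i f)
premises-bounded (∧E d i j f) w n ih = λ where
    (here refl)         → conj , λ ()
    (there (here refl)) → inj₁ ≼-refl , λ { (here refl) _ → Bounded-≼ (≼-∧ˡ ≼-refl) conj
                                          ; (there (here refl)) _ → Bounded-≼ (≼-∧ʳ ≼-refl) conj }
  where conj = major-premise-bounded n (here refl)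
premises-bounded (∨I₁ B d i f) w n ih = λ where
    (here refl)         → Bounded-≼ (≼-∨ˡ ≼-refl) disj , λ ()
    (there (here refl)) → inj₁ ≼-refl , intro-discharge-bounded n (im-∨I₁ B d i f)
  where disj = intro-major-bounded w n ih (im-∨I₁ B d i f)
premises-bounded (∨I₂ A d i f) w n ih = λ where
    (here refl)         → Bounded-≼ (≼-∨ʳ ≼-refl) disj , λ ()
    (there (here refl)) → inj₁ ≼-refl , intro-discharge-bounded n (im-∨I₂ A d i f)
  where disj = intro-major-bounded w n ih (im-∨I₂ A d i f)
premises-bounded (∨E d i f j g) w n ih = λ where
    (here refl)                 → disj , λ ()
    (there (here refl))         → inj₁ ≼-refl , sole-discharge-bounded (Bounded-≼ (≼-∨ˡ ≼-refl) disj)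
    (there (there (here refl))) → inj₁ ≼-refl , sole-discharge-bounded (Bounded-≼ (≼-∨ʳ ≼-refl) disj)
  where disj = major-premise-bounded n (here refl)
premises-bounded (⊃I A d i f) w n ih = λ where
    (here refl)         → Bounded-≼ (≼-⊃ʳ ≼-refl) imp , λ ()
    (there (here refl)) → inj₁ ≼-refl , intro-discharge-bounded n (im-⊃I A d i f)
  where imp = intro-major-bounded w n ih (im-⊃I A d i f)
premises-bounded (TR A B i f j g) w n ih = λ where
    (here refl)         → inj₁ ≼-refl , sole-discharge-bounded (Bounded-≼ (≼-⊃ˡ ≼-refl) imp)
    (there (here refl)) → inj₁ ≼-refl , intro-discharge-bounded n (im-TR A B i f j g)
  where imp = intro-major-bounded w n ih (im-TR A B i f j g)
premises-bounded (⊃E d e i f) w n ih = λ where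
    (here refl)                 → imp , λ ()
    (there (here refl))         → Bounded-≼ (≼-⊃ˡ ≼-refl) imp , λ ()
    (there (there (here refl))) → inj₁ ≼-refl , sole-discharge-bounded (Bounded-≼ (≼-⊃ʳ ≼-refl) imp)
  where imp = major-premise-bounded n (here refl)
premises-bounded (¬I A i f j g) w n ih = λ where
    (here refl)         → inj₁ ≼-refl , sole-discharge-bounded (Bounded-≼ (≼-¬ ≼-refl) neg)
    (there (here refl)) → inj₁ ≼-refl , intro-discharge-bounded n (im-¬I A i f j g)
  where neg = intro-major-bounded w n ih (im-¬I A i f j g)
premises-bounded (¬E C d e) w n ih = λ where
    (here refl)         → neg , λ ()
    (there (here refl)) → Bounded-≼ (≼-¬ ≼-refl) neg , λ ()
  where neg = major-premise-bounded n (here refl)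

normal-occurrences-bounded : ∀ {C} (D : Ded C) → WF D → Normal D → OccurrencesBounded D
normal-occurrences-bounded = premise-induction (λ D → WF D → Normal D → OccurrencesBounded D) step-bounded
  where
  step-bounded : ∀ {C} (D : Ded C) →
                 (∀ {p} → p ∈ prems D → WF (sub p) → Normal (sub p) → OccurrencesBounded (sub p)) →
                 WF D → Normal D → OccurrencesBounded D
  step-bounded D ih w n F (_ , here)        = inj₁ ≼-refl
  step-bounded D ih w n F (_ , there pm F⊑) =
    bounded-from-premise w pm (premises-bounded D w n ih′ pm) (ih′ pm F (_ , F⊑))
    where
    ih′ : PremisesBounded D
    ih′ pm = ih pm (WF-premise pm w) (Normal-premise pm n)

corollary2 : ∀ {C} (D : Ded C) → WF D → Normal D →
    ∀ F → Occurs F D → F ≼ C ⊎ (∃[ i ] ∃[ A ] (OpenAss i A D × F ≼ A))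
corollary2 D w n F occ with normal-occurrences-bounded D w n F occ
... | inj₁ F≼C                = inj₁ F≼C
... | inj₂ (i , A , mo , F≼A) = inj₂ (i , A , MajorOpen⇒OpenAss mo , F≼A)
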